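{- There are absolute constants $c_1,c_2,c_3,c_4>0$ such that for arbitrarily large $n$ there exist a finite set $A \subseteq \mathbb{Q}_{>0}$ with $c_1 n \leq |A| \leq c_2 n$ and a bipartite graph $G$ with both vertex classes equal to (copies of) $A$ and edge set $E(G) \subseteq A \times A$ with $|E(G)| \geq c_3 n^{3/2}$, such that $$|A +_G A| + |A /_G A| + |(A+1) /_G (A+1)| + |A -_G A| \leq c_4\, n.$$
   Context: For a finite set $A \subseteq \mathbb{R}$ and edge set $E(G) \subseteq A \times A$, define $A+_G A := \{a+b : (a,b)\in E(G)\}$, $A-_G A := \{a-b : (a,b)\in E(G)\}$, and, whenever the denominators are nonzero, $(A+x)/_G(A+y) := \{\frac{a+x}{b+y} : (a,b) \in E(G)\}$ for $x,y\in\mathbb{R}$; in particular $A/_G A = \{a/b : (a,b) \in E(G)\}$. -}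

module Defs where

open import Data.Nat using (ℕ)
open import Data.Integer using (+_)
open import Data.Rational using (ℚ; 0ℚ; 1ℚ; _+_; _-_; _÷_; _/_; ≢-nonZero)
open import Data.Rational.Properties using (_≟_)
open import Data.Product using (_×_; _,_)
open import Data.List using (List; map; deduplicate; length)
open import Relation.Nullary using (yes; no)

ℕtoℚ : ℕ → ℚ
ℕtoℚ n = + n / 1

-- total division; only ever applied with nonzero denominators below
-- (A ⊆ ℚ_{>0}, so b ≠ 0 and b + 1 ≠ 0)
_÷'_ : ℚ → ℚ → ℚ
p ÷' q with q ≟ 0ℚ
... | yes _ = 0ℚ
... | no q≢0 = _÷_ p q {{≢-nonZero q≢0}}

card : List ℚ → ℕ
card xs = length (deduplicate _≟_ xs)

-- restricted sum/difference/quotient sets, as lists (duplicates allowed;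
-- sizes are measured with card)
sumG : List (ℚ × ℚ) → List ℚ
sumG E = map (λ { (a , b) → a + b }) E

diffG : List (ℚ × ℚ) → List ℚ
diffG E = map (λ { (a , b) → a - b }) E

quotShiftG : ℚ → ℚ → List (ℚ × ℚ) → List ℚ
quotShiftG x y E = map (λ { (a , b) → (a + x) ÷' (b + y) }) E

quotG : List (ℚ × ℚ) → List ℚ
quotG E = quotShiftG 0ℚ 0ℚ E

module Submission where

-- For m ≥ 1 put n = m², P = m² + m and
--   A = { (P + u)/(j + 1) : u, j < m }  ∪  { (v + 1)/(j + 1) : v, j < m },
--   E = { ((P + u)/(j + 1), (v + 1)/(j + 1)) : u, v, j < m }.
-- The endpoints of an edge share their denominator, so along E
--   sum = (P + (u + v + 1))/(j + 1),       difference = (m² + (m + u - v - 1))/(j + 1),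
--   quotient = (P + u)/(v + 1),            shifted quotient = (P + (u + j + 1))/(v + j + 2),
-- all lying in "layers" {(c + w)/(k + 1) : w < a, k < b} with c ∈ {m², P} and
-- a, b ≤ 2m; together these have 9m² = 9n elements.  Meanwhile |E| = m³ = n^{3/2}
-- and n ≤ |A| ≤ 2n, the lower bounds resting on a window lemma: as P ≥ m², the
-- fraction (P + u)/(j + 1) with u, j < m determines u and j.

module Fractions where

  open import Defs using (ℕtoℚ; _÷'_)
  open import Data.Nat as ℕ using (ℕ; suc)
  open import Data.Nat.Tactic.RingSolver using (solve)
  open import Data.Integer as ℤ using (+_)
  open import Data.Integer.Properties using (pos-+; pos-*; *-identityʳ)
  open import Data.List using (_∷_; [])
  open import Data.Rational using (ℚ; _/_; 0ℚ; 1ℚ; _+_; _-_; _*_; -_; 1/_; _≤_; toℚᵘ; Positive; ≢-nonZero)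
  open import Data.Rational.Properties as ℚP using (_≟_)
  open import Data.Rational.Unnormalised as ℚᵘ using (mkℚᵘ; *≡*; *≤*) renaming (_≃_ to _≃ᵘ_)
  import Data.Rational.Unnormalised.Properties as ℚᵘP
  open import Relation.Binary.PropositionalEquality
  open import Relation.Nullary using (yes; no)
  open import Data.Empty using (⊥-elim)

  frac : ℕ → ℕ → ℚ
  frac x d = + x / suc d

  toℚᵘ-frac : ∀ x d → toℚᵘ (frac x d) ≃ᵘ mkℚᵘ (+ x) d
  toℚᵘ-frac x d = ℚP.toℚᵘ-fromℚᵘ (mkℚᵘ (+ x) d)

  frac-cross : ∀ x d y e → x ℕ.* suc e ≡ y ℕ.* suc d → frac x d ≡ frac y e
  frac-cross x d y e eq = ℚP.fromℚᵘ-cong {mkℚᵘ (+ x) d} {mkℚᵘ (+ y) e} (*≡* (begin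
    + x ℤ.* + suc e    ≡⟨ pos-* x (suc e) ⟨
    + (x ℕ.* suc e)    ≡⟨ cong +_ eq ⟩
    + (y ℕ.* suc d)    ≡⟨ pos-* y (suc d) ⟩
    + y ℤ.* + suc d    ∎))
    where open ≡-Reasoning

  frac-injective : ∀ x d y e → frac x d ≡ frac y e → x ℕ.* suc e ≡ y ℕ.* suc d
  frac-injective x d y e = ℚP.normalize-injective-≃ x y (suc d) (suc e)

  frac-+ : ∀ x d y e z f → (x ℕ.* suc e ℕ.+ y ℕ.* suc d) ℕ.* suc f ≡ z ℕ.* suc (e ℕ.+ d ℕ.* suc e) →
           frac x d + frac y e ≡ frac z f
  frac-+ x d y e z f eq = ℚP.toℚᵘ-injective (begin
    toℚᵘ (frac x d + frac y e)            ≈⟨ ℚP.toℚᵘ-homo-+ (frac x d) (frac y e) ⟩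
    toℚᵘ (frac x d) ℚᵘ.+ toℚᵘ (frac y e)  ≈⟨ ℚᵘP.+-cong (toℚᵘ-frac x d) (toℚᵘ-frac y e) ⟩
    mkℚᵘ (+ x) d ℚᵘ.+ mkℚᵘ (+ y) e        ≡⟨ cong (λ t → mkℚᵘ t (e ℕ.+ d ℕ.* suc e)) numerator ⟩
    mkℚᵘ (+ s) (e ℕ.+ d ℕ.* suc e)        ≈⟨ toℚᵘ-frac s (e ℕ.+ d ℕ.* suc e) ⟨
    toℚᵘ (frac s (e ℕ.+ d ℕ.* suc e))     ≡⟨ cong toℚᵘ (frac-cross s (e ℕ.+ d ℕ.* suc e) z f eq) ⟩
    toℚᵘ (frac z f)                       ∎)
    where
    open ℚᵘP.≃-Reasoning
    s = x ℕ.* suc e ℕ.+ y ℕ.* suc d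
    numerator : + x ℤ.* + suc e ℤ.+ + y ℤ.* + suc d ≡ + s
    numerator = trans (cong₂ ℤ._+_ (sym (pos-* x (suc e))) (sym (pos-* y (suc d))))
                      (sym (pos-+ (x ℕ.* suc e) (y ℕ.* suc d)))

  frac-* : ∀ x d y e z f → x ℕ.* y ℕ.* suc f ≡ z ℕ.* suc (e ℕ.+ d ℕ.* suc e) →
           frac x d * frac y e ≡ frac z f
  frac-* x d y e z f eq = ℚP.toℚᵘ-injective (begin
    toℚᵘ (frac x d * frac y e)            ≈⟨ ℚP.toℚᵘ-homo-* (frac x d) (frac y e) ⟩
    toℚᵘ (frac x d) ℚᵘ.* toℚᵘ (frac y e)  ≈⟨ ℚᵘP.*-cong (toℚᵘ-frac x d) (toℚᵘ-frac y e) ⟩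
    mkℚᵘ (+ x) d ℚᵘ.* mkℚᵘ (+ y) e        ≡⟨ cong (λ t → mkℚᵘ t (e ℕ.+ d ℕ.* suc e)) (sym (pos-* x y)) ⟩
    mkℚᵘ (+ (x ℕ.* y)) (e ℕ.+ d ℕ.* suc e) ≈⟨ toℚᵘ-frac (x ℕ.* y) (e ℕ.+ d ℕ.* suc e) ⟨
    toℚᵘ (frac (x ℕ.* y) (e ℕ.+ d ℕ.* suc e)) ≡⟨ cong toℚᵘ (frac-cross (x ℕ.* y) (e ℕ.+ d ℕ.* suc e) z f eq) ⟩
    toℚᵘ (frac z f)                       ∎)
    where open ℚᵘP.≃-Reasoning

  frac-+-common : ∀ x y d → frac x d + frac y d ≡ frac (x ℕ.+ y) d
  frac-+-common x y d = frac-+ x d y d (x ℕ.+ y) d (solve (x ∷ y ∷ d ∷ []))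

  frac-∸-common : ∀ x y z d → z ℕ.+ y ≡ x → frac x d - frac y d ≡ frac z d
  frac-∸-common x y z d z+y≡x = begin
    frac x d - frac y d                  ≡⟨ cong (λ t → frac t d - frac y d) (sym z+y≡x) ⟩
    frac (z ℕ.+ y) d - frac y d          ≡⟨ cong (_- frac y d) (frac-+-common z y d) ⟨
    frac z d + frac y d - frac y d       ≡⟨ ℚP.+-assoc (frac z d) (frac y d) (- frac y d) ⟩
    frac z d + (frac y d - frac y d)     ≡⟨ cong (λ t → frac z d + t) (ℚP.+-inverseʳ (frac y d)) ⟩
    frac z d + 0ℚ                        ≡⟨ ℚP.+-identityʳ (frac z d) ⟩
    frac z d                             ∎
    where open ≡-Reasoning

  frac-+1 : ∀ x d → frac x d + 1ℚ ≡ frac (x ℕ.+ suc d) d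
  frac-+1 x d = frac-+ x d 1 0 (x ℕ.+ suc d) d (solve (x ∷ d ∷ []))

  frac-rescale : ∀ x e d → frac x e * frac (suc e) d ≡ frac x d
  frac-rescale x e d = frac-* x e (suc e) d x d (solve (x ∷ e ∷ d ∷ []))

  frac-pos : ∀ x d → Positive (frac (suc x) d)
  frac-pos x d = ℚP.normalize-pos (suc x) (suc d)

  frac-nonzero : ∀ x d → frac (suc x) d ≢ 0ℚ
  frac-nonzero x d eq with subst Positive eq (frac-pos x d)
  ... | ()

  ÷'-unique : ∀ {x y z} → y ≢ 0ℚ → z * y ≡ x → x ÷' y ≡ z
  ÷'-unique {x} {y} {z} y≢0 zy≡x with y ≟ 0ℚ
  ... | yes y≡0 = ⊥-elim (y≢0 y≡0)
  ... | no y≢0′ = begin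
    x * 1/ y         ≡⟨ cong (_* 1/ y) (sym zy≡x) ⟩
    z * y * 1/ y     ≡⟨ ℚP.*-assoc z y (1/ y) ⟩
    z * (y * 1/ y)   ≡⟨ cong (z *_) (ℚP.*-inverseʳ y) ⟩
    z * 1ℚ           ≡⟨ ℚP.*-identityʳ z ⟩
    z                ∎
    where
    open ≡-Reasoning
    instance _ = ≢-nonZero y≢0′

  ℕtoℚ-+ : ∀ a b → ℕtoℚ a + ℕtoℚ b ≡ ℕtoℚ (a ℕ.+ b)
  ℕtoℚ-+ a b = frac-+-common a b 0

  ℕtoℚ-* : ∀ a b → ℕtoℚ a * ℕtoℚ b ≡ ℕtoℚ (a ℕ.* b)
  ℕtoℚ-* a b = frac-* a 0 b 0 (a ℕ.* b) 0 (solve (a ∷ b ∷ []))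

  ℕtoℚ-*₃ : ∀ a b c → ℕtoℚ a * ℕtoℚ b * ℕtoℚ c ≡ ℕtoℚ (a ℕ.* b ℕ.* c)
  ℕtoℚ-*₃ a b c = trans (cong (_* ℕtoℚ c) (ℕtoℚ-* a b)) (ℕtoℚ-* (a ℕ.* b) c)

  ℕtoℚ-+₄ : ∀ a b c d → ℕtoℚ a + ℕtoℚ b + ℕtoℚ c + ℕtoℚ d ≡ ℕtoℚ (a ℕ.+ b ℕ.+ c ℕ.+ d)
  ℕtoℚ-+₄ a b c d = begin
    ℕtoℚ a + ℕtoℚ b + ℕtoℚ c + ℕtoℚ d   ≡⟨ cong (λ t → t + ℕtoℚ c + ℕtoℚ d) (ℕtoℚ-+ a b) ⟩
    ℕtoℚ (a ℕ.+ b) + ℕtoℚ c + ℕtoℚ d    ≡⟨ cong (_+ ℕtoℚ d) (ℕtoℚ-+ (a ℕ.+ b) c) ⟩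
    ℕtoℚ (a ℕ.+ b ℕ.+ c) + ℕtoℚ d       ≡⟨ ℕtoℚ-+ (a ℕ.+ b ℕ.+ c) d ⟩
    ℕtoℚ (a ℕ.+ b ℕ.+ c ℕ.+ d)          ∎
    where open ≡-Reasoning

  ℕtoℚ-mono-≤ : ∀ {a b} → a ℕ.≤ b → ℕtoℚ a ≤ ℕtoℚ b
  ℕtoℚ-mono-≤ {a} {b} a≤b = ℚP.toℚᵘ-cancel-≤
    (ℚᵘP.≤-respˡ-≃ (ℚᵘP.≃-sym (toℚᵘ-frac a 0)) (ℚᵘP.≤-respʳ-≃ (ℚᵘP.≃-sym (toℚᵘ-frac b 0))
      (*≤* (subst₂ ℤ._≤_ (sym (*-identityʳ (+ a))) (sym (*-identityʳ (+ b))) (ℤ.+≤+ a≤b)))))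

module Counting where

  open import Defs using (card)
  open import Data.Nat using (suc; _≤_; _*_; _+_; z≤n; s≤s)
  open import Data.Product using (_×_; _,_)
  open import Data.List using (List; []; _∷_; _++_; map; length; cartesianProduct)
  open import Data.List.Properties using (length-++; length-map; length-removeAt′)
  open import Data.List.Relation.Unary.All as All using (All; _∷_)
  open import Data.List.Relation.Unary.All.Properties using (map⁺)
  open import Data.List.Relation.Unary.Any using (here; there; _─_)
  open import Data.List.Relation.Unary.Unique.Propositional using (Unique)
  open import Data.List.Relation.Unary.AllPairs using ([]; _∷_)
  open import Data.List.Relation.Unary.Unique.DecPropositional.Properties using (deduplicate-!)
  open import Data.List.Membership.Propositional using (_∈_)
  open import Data.List.Membership.Propositional.Properties using (∈-deduplicate⁻)
  open import Data.Rational.Properties using (_≟_)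
  open import Relation.Binary.PropositionalEquality
  open import Relation.Nullary using (¬_)
  open import Data.Empty using (⊥-elim)

  ∈-─ : ∀ {A : Set} {x y : A} {ys} (x∈ys : x ∈ ys) → y ∈ ys → ¬ y ≡ x → y ∈ (ys ─ x∈ys)
  ∈-─ (here refl) (here refl) y≢x = ⊥-elim (y≢x refl)
  ∈-─ (here _)    (there y∈)  y≢x = y∈
  ∈-─ (there _)   (here y≡)   y≢x = here y≡
  ∈-─ (there x∈)  (there y∈)  y≢x = there (∈-─ x∈ y∈ y≢x)

  unique-length-≤ : ∀ {A : Set} {xs ys : List A} → Unique xs → All (_∈ ys) xs → length xs ≤ length ys
  unique-length-≤ {xs = []} _ _ = z≤n
  unique-length-≤ {xs = x ∷ xs} {ys} (x∉xs ∷ uniq) (x∈ys ∷ xs⊆ys) =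
    subst (suc (length xs) ≤_) (sym (length-removeAt′ ys _))
      (s≤s (unique-length-≤ uniq (All.zipWith keep (x∉xs , xs⊆ys))))
    where
    keep : ∀ {y} → ¬ x ≡ y × y ∈ ys → y ∈ (ys ─ x∈ys)
    keep (x≢y , y∈ys) = ∈-─ x∈ys y∈ys (λ y≡x → x≢y (sym y≡x))

  card-≤ : ∀ {xs ys} → All (_∈ ys) xs → card xs ≤ length ys
  card-≤ {xs} xs⊆ys = unique-length-≤ (deduplicate-! _≟_ xs)
    (All.tabulate (λ x∈ → All.lookup xs⊆ys (∈-deduplicate⁻ _≟_ xs x∈)))

  map-unique : ∀ {A B : Set} (f : A → B) {xs} → (∀ {x y} → x ∈ xs → y ∈ xs → f x ≡ f y → x ≡ y) →
               Unique xs → Unique (map f xs)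
  map-unique f {[]} inj [] = []
  map-unique f {x ∷ xs} inj (x∉xs ∷ uniq) =
    map⁺ (All.tabulate (λ y∈ fx≡fy → All.lookup x∉xs y∈ (inj (here refl) (there y∈) fx≡fy)))
    ∷ map-unique f (λ x∈ y∈ → inj (there x∈) (there y∈)) uniq

  length-cartesianProduct : ∀ {A B : Set} (xs : List A) (ys : List B) →
                            length (cartesianProduct xs ys) ≡ length xs * length ys
  length-cartesianProduct [] ys = refl
  length-cartesianProduct (x ∷ xs) ys = begin
    length (map (x ,_) ys ++ cartesianProduct xs ys)
      ≡⟨ length-++ (map (x ,_) ys) ⟩
    length (map (x ,_) ys) + length (cartesianProduct xs ys)
      ≡⟨ cong₂ _+_ (length-map (x ,_) ys) (length-cartesianProduct xs ys) ⟩
    length ys + length xs * length ys ∎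
    where open ≡-Reasoning

module Window where

  open import Data.Nat
  open import Data.Nat.Properties
    using (*-distribʳ-+; *-suc; +-comm; +-monoʳ-<; *-monoʳ-≤; *-monoˡ-≤; *-mono-≤; m≤m+n; m≤n+m;
           <-cmp; <-irrefl; +-cancelˡ-≡; *-cancelʳ-≡; module ≤-Reasoning)
  open import Data.Product using (_×_; _,_)
  open import Relation.Binary.PropositionalEquality
  open import Relation.Binary.Definitions using (tri<; tri≈; tri>)
  open import Data.Empty using (⊥-elim)

  base : ℕ → ℕ
  base m = m * m + m

  -- Numerators lie in a window [P, P + m) with P ≥ m², so a larger
  -- denominator always yields a larger cross product.
  cross-<-window : ∀ {m u u' j j'} → u' < m → j < m → j < j' →
                   (base m + u') * suc j < (base m + u) * suc j'
  cross-<-window {m} {u} {u'} {j} {j'} u'<m j<m j<j' = begin-strict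
    (base m + u') * suc j           ≡⟨ *-distribʳ-+ (suc j) (base m) u' ⟩
    base m * suc j + u' * suc j     <⟨ +-monoʳ-< (base m * suc j) small ⟩
    base m * suc j + base m         ≡⟨ +-comm (base m * suc j) (base m) ⟩
    base m + base m * suc j         ≡⟨ *-suc (base m) (suc j) ⟨
    base m * suc (suc j)            ≤⟨ *-monoʳ-≤ (base m) (s≤s j<j') ⟩
    base m * suc j'                 ≤⟨ *-monoˡ-≤ (suc j') (m≤m+n (base m) u) ⟩
    (base m + u) * suc j'           ∎
    where
    open ≤-Reasoning
    small : u' * suc j < base m
    small = begin-strict
      u' * suc j       <⟨ s≤s (m≤n+m (u' * suc j) j) ⟩
      suc u' * suc j   ≤⟨ *-mono-≤ u'<m j<m ⟩
      m * m            ≤⟨ m≤m+n (m * m) m ⟩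
      base m           ∎

  window : ∀ {m u u' j j'} → u < m → u' < m → j < m → j' < m →
           (base m + u) * suc j' ≡ (base m + u') * suc j → u ≡ u' × j ≡ j'
  window {m} {u} {u'} {j} {j'} u<m u'<m j<m j'<m eq with <-cmp j j'
  ... | tri< j<j' _ _ = ⊥-elim (<-irrefl (sym eq) (cross-<-window u'<m j<m j<j'))
  ... | tri> _ _ j'<j = ⊥-elim (<-irrefl eq (cross-<-window u<m j'<m j'<j))
  ... | tri≈ _ refl _ = +-cancelˡ-≡ (base m) u u' (*-cancelʳ-≡ (base m + u) (base m + u') (suc j) eq) , refl

module Construction where

  open import Defs
  open import Data.Nat hiding (_≟_)
  open import Data.Nat.Properties
    using (+-assoc; +-mono-≤; +-mono-<-≤; +-monoʳ-<; *-cancelʳ-≡; m∸n+n≡m; m∸n≤m; m≤m+n;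
           ≤-trans; ≤-<-trans; module ≤-Reasoning)
  open import Data.Nat.Tactic.RingSolver using (solve)
  open import Data.Product using (_×_; _,_; proj₁; proj₂)
  open import Data.List using (List; []; _∷_; map; length; upTo; cartesianProduct; deduplicate; _++_)
  open import Data.List.Properties using (length-map; length-upTo; length-++; length-deduplicate)
  open import Data.List.Relation.Unary.All as All using (All)
  open import Data.List.Relation.Unary.All.Properties using (map⁺; ++⁺; deduplicate⁺)
  open import Data.List.Relation.Unary.Unique.Propositional using (Unique)
  open import Data.List.Relation.Unary.Unique.Propositional.Properties using (cartesianProduct⁺; upTo⁺)
  open import Data.List.Relation.Unary.Unique.DecPropositional.Properties using (deduplicate-!)
  open import Data.List.Membership.Propositional using (_∈_)
  open import Data.List.Membership.Propositional.Properties
    using (∈-map⁺; ∈-++⁺ˡ; ∈-++⁺ʳ; ∈-deduplicate⁺; ∈-upTo⁺; ∈-upTo⁻; ∈-cartesianProduct⁺; ∈-cartesianProduct⁻)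
  open import Data.Rational as ℚ using (ℚ; Positive; 1ℚ)
  open import Data.Rational.Properties as ℚP using (_≟_)
  open import Relation.Binary.PropositionalEquality
  open Fractions
  open Counting
  open Window

  grid : ℕ → ℕ → List (ℕ × ℕ)
  grid a b = cartesianProduct (upTo a) (upTo b)

  ∈-grid⁺ : ∀ {a b w j} → w < a → j < b → (w , j) ∈ grid a b
  ∈-grid⁺ w<a j<b = ∈-cartesianProduct⁺ (∈-upTo⁺ w<a) (∈-upTo⁺ j<b)

  ∈-grid⁻ : ∀ {a b w j} → (w , j) ∈ grid a b → w < a × j < b
  ∈-grid⁻ {a} {b} wj∈ with ∈-cartesianProduct⁻ (upTo a) (upTo b) wj∈
  ... | w∈ , j∈ = ∈-upTo⁻ w∈ , ∈-upTo⁻ j∈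

  length-grid : ∀ a b → length (grid a b) ≡ a * b
  length-grid a b = trans (length-cartesianProduct (upTo a) (upTo b))
                          (cong₂ _*_ (length-upTo a) (length-upTo b))

  layerFrac : ℕ → ℕ × ℕ → ℚ
  layerFrac c (w , j) = frac (c + w) j

  layer : ℕ → ℕ → ℕ → List ℚ
  layer c a b = map (layerFrac c) (grid a b)

  ∈-layer⁺ : ∀ c {a b w j} → w < a → j < b → frac (c + w) j ∈ layer c a b
  ∈-layer⁺ c w<a j<b = ∈-map⁺ (layerFrac c) (∈-grid⁺ w<a j<b)

  length-layer : ∀ c a b → length (layer c a b) ≡ a * b
  length-layer c a b = trans (length-map (layerFrac c) (grid a b)) (length-grid a b)

  layer-positive : ∀ c a b → All Positive (layer (suc c) a b)
  layer-positive c a b = map⁺ (All.universal (λ { (w , j) → frac-pos (c + w) j }) (grid a b))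

  base-layer-unique : ∀ m → Unique (layer (base m) m m)
  base-layer-unique m = map-unique (layerFrac (base m)) injective (cartesianProduct⁺ (upTo⁺ m) (upTo⁺ m))
    where
    injective : ∀ {x y} → x ∈ grid m m → y ∈ grid m m → layerFrac (base m) x ≡ layerFrac (base m) y → x ≡ y
    injective {u , j} {u' , j'} x∈ y∈ eq with ∈-grid⁻ {m} {m} x∈ | ∈-grid⁻ {m} {m} y∈
    ... | u<m , j<m | u'<m , j'<m with window u<m u'<m j<m j'<m (frac-injective (base m + u) j (base m + u') j' eq)
    ... | refl , refl = refl

  vertexList : ℕ → List ℚ
  vertexList m = layer (base m) m m ++ layer 1 m m

  A : ℕ → List ℚ
  A m = deduplicate _≟_ (vertexList m)

  edge : ℕ → ℕ × ℕ × ℕ → ℚ × ℚ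
  edge m (u , v , j) = frac (base m + u) j , frac (1 + v) j

  cube : ℕ → List (ℕ × ℕ × ℕ)
  cube m = cartesianProduct (upTo m) (grid m m)

  ∈-cube⁻ : ∀ {m u v j} → (u , v , j) ∈ cube m → u < m × v < m × j < m
  ∈-cube⁻ {m} t∈ with ∈-cartesianProduct⁻ (upTo m) (grid m m) t∈
  ... | u∈ , vj∈ with ∈-grid⁻ vj∈
  ... | v<m , j<m = ∈-upTo⁻ u∈ , v<m , j<m

  E : ℕ → List (ℚ × ℚ)
  E m = map (edge m) (cube m)

  all-edges : ∀ {P : ℚ × ℚ → Set} m → (∀ {u v j} → u < m → v < m → j < m → P (edge m (u , v , j))) →
              All P (E m)
  all-edges m P-edge = map⁺ (All.tabulate (λ { {u , v , j} t∈ →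
    let (u<m , v<m , j<m) = ∈-cube⁻ t∈ in P-edge u<m v<m j<m }))

  A-unique : ∀ m → Unique (A m)
  A-unique m = deduplicate-! _≟_ (vertexList m)

  -- (For m = N + 1 both offsets are successors: base (N + 1) = 1 + (N + N(N + 1) + (N + 1)).)
  A-positive : ∀ N → All Positive (A (suc N))
  A-positive N = deduplicate⁺ _≟_ {xs = vertexList (suc N)}
    (++⁺ (layer-positive (N + N * suc N + suc N) (suc N) (suc N)) (layer-positive 0 (suc N) (suc N)))

  edges-in-A : ∀ m → All (λ e → (proj₁ e ∈ A m) × (proj₂ e ∈ A m)) (E m)
  edges-in-A m = all-edges m (λ u<m v<m j<m →
    ∈-deduplicate⁺ _≟_ (∈-++⁺ˡ (∈-layer⁺ (base m) u<m j<m)) ,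
    ∈-deduplicate⁺ _≟_ (∈-++⁺ʳ (layer (base m) m m) (∈-layer⁺ 1 v<m j<m)))

  -- Distinct indices give distinct edges: the first endpoint fixes u, j by the
  -- window lemma, then the second fixes v.
  E-unique : ∀ m → Unique (E m)
  E-unique m = map-unique (edge m) injective (cartesianProduct⁺ (upTo⁺ m) (cartesianProduct⁺ (upTo⁺ m) (upTo⁺ m)))
    where
    injective : ∀ {x y} → x ∈ cube m → y ∈ cube m → edge m x ≡ edge m y → x ≡ y
    injective {u , v , j} {u' , v' , j'} x∈ y∈ eq with ∈-cube⁻ {m} x∈ | ∈-cube⁻ {m} y∈
    ... | u<m , _ , j<m | u'<m , _ , j'<m with window u<m u'<m j<m j'<m (frac-injective (base m + u) j (base m + u') j' (cong proj₁ eq))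
    ... | refl , refl with *-cancelʳ-≡ (suc v) (suc v') (suc j) (frac-injective (suc v) j (suc v') j (cong proj₂ eq))
    ... | refl = refl

  -- n ≤ |A| ≤ 2n for n = m²: A contains the duplicate-free large layer and
  -- is obtained from two layers of m² entries each.
  A-lower : ∀ m → m * m ≤ length (A m)
  A-lower m = subst (_≤ length (A m)) (length-layer (base m) m m)
    (unique-length-≤ (base-layer-unique m)
      (All.tabulate (λ x∈ → ∈-deduplicate⁺ _≟_ (∈-++⁺ˡ x∈))))

  A-upper : ∀ m → length (A m) ≤ 2 * (m * m)
  A-upper m = begin
    length (A m)                                         ≤⟨ length-deduplicate _≟_ (vertexList m) ⟩
    length (vertexList m)                                ≡⟨ length-++ (layer (base m) m m) ⟩
    length (layer (base m) m m) + length (layer 1 m m)   ≡⟨ cong₂ _+_ (length-layer (base m) m m) (length-layer 1 m m) ⟩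
    m * m + m * m                                        ≡⟨ solve (m ∷ []) ⟩
    2 * (m * m)                                          ∎
    where open ≤-Reasoning

  E-length : ∀ m → length (E m) ≡ m * (m * m)
  E-length m = begin
    length (E m)                          ≡⟨ length-map (edge m) (cube m) ⟩
    length (cube m)                       ≡⟨ length-cartesianProduct (upTo m) (grid m m) ⟩
    length (upTo m) * length (grid m m)   ≡⟨ cong₂ _*_ (length-upTo m) (length-grid m m) ⟩
    m * (m * m)                           ∎
    where open ≡-Reasoning

  images-in : ∀ m {f : ℚ × ℚ → ℚ} {ys} →
              (∀ {u v j} → u < m → v < m → j < m → f (edge m (u , v , j)) ∈ ys) → All (_∈ ys) (map f (E m))
  images-in m image∈ = map⁺ (all-edges m image∈)

  -- (P + u)/(j + 1) + (v + 1)/(j + 1) = (P + (u + v + 1))/(j + 1).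
  sums-in-layer : ∀ m → All (_∈ layer (base m) (m + m) m) (sumG (E m))
  sums-in-layer m = images-in m (λ {u} {v} {j} u<m v<m j<m →
    subst (_∈ layer (base m) (m + m) m)
      (sym (trans (frac-+-common (base m + u) (suc v) j) (cong (λ t → frac t j) (+-assoc (base m) u (suc v)))))
      (∈-layer⁺ (base m) (+-mono-<-≤ u<m v<m) j<m))

  -- (P + u)/(j + 1) ÷ (v + 1)/(j + 1) = (P + u)/(v + 1).
  quotients-in-layer : ∀ m → All (_∈ layer (base m) m m) (quotG (E m))
  quotients-in-layer m = images-in m (λ {u} {v} {j} u<m v<m j<m →
    subst (_∈ layer (base m) m m)
      (sym (trans (cong₂ _÷'_ (ℚP.+-identityʳ (frac (base m + u) j)) (ℚP.+-identityʳ (frac (suc v) j)))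
                  (÷'-unique (frac-nonzero v j) (frac-rescale (base m + u) v j))))
      (∈-layer⁺ (base m) u<m v<m))

  -- ((P + u)/(j + 1) + 1) ÷ ((v + 1)/(j + 1) + 1) = (P + (u + j + 1))/(v + j + 2).
  shifted-quotients-in-layer : ∀ m → All (_∈ layer (base m) (m + m) (m + m)) (quotShiftG 1ℚ 1ℚ (E m))
  shifted-quotients-in-layer m = images-in m (λ {u} {v} {j} u<m v<m j<m →
    subst (_∈ layer (base m) (m + m) (m + m))
      (sym (begin
        (frac (base m + u) j ℚ.+ 1ℚ) ÷' (frac (suc v) j ℚ.+ 1ℚ)
          ≡⟨ cong₂ _÷'_ (frac-+1 (base m + u) j) (frac-+1 (suc v) j) ⟩
        frac (base m + u + suc j) j ÷' frac (suc v + suc j) j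
          ≡⟨ ÷'-unique (frac-nonzero (v + suc j) j) (frac-rescale (base m + u + suc j) (v + suc j) j) ⟩
        frac (base m + u + suc j) (v + suc j)
          ≡⟨ cong (λ t → frac t (v + suc j)) (+-assoc (base m) u (suc j)) ⟩
        frac (base m + (u + suc j)) (v + suc j) ∎))
      (∈-layer⁺ (base m) (+-mono-<-≤ u<m j<m) (+-mono-<-≤ v<m j<m)))
    where open ≡-Reasoning

  -- (P + u)/(j + 1) - (v + 1)/(j + 1) = (m² + (m + u - v - 1))/(j + 1).
  differences-in-layer : ∀ m → All (_∈ layer (m * m) (m + m) m) (diffG (E m))
  differences-in-layer m = images-in m (λ {u} {v} {j} u<m v<m j<m →
    let w = m + u ∸ suc v
        numerators : m * m + w + suc v ≡ base m + u
        numerators = begin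
          m * m + w + suc v     ≡⟨ +-assoc (m * m) w (suc v) ⟩
          m * m + (w + suc v)   ≡⟨ cong (m * m +_) (m∸n+n≡m (≤-trans v<m (m≤m+n m u))) ⟩
          m * m + (m + u)       ≡⟨ +-assoc (m * m) m u ⟨
          base m + u            ∎
    in subst (_∈ layer (m * m) (m + m) m) (sym (frac-∸-common (base m + u) (suc v) (m * m + w) j numerators))
         (∈-layer⁺ (m * m) (≤-<-trans (m∸n≤m (m + u) (suc v)) (+-monoʳ-< m u<m)) j<m))
    where open ≡-Reasoning

  restricted-sets-bound : ∀ m → card (sumG (E m)) + card (quotG (E m)) + card (quotShiftG 1ℚ 1ℚ (E m))
                                  + card (diffG (E m)) ≤ 9 * (m * m)
  restricted-sets-bound m = begin
    card (sumG (E m)) + card (quotG (E m)) + card (quotShiftG 1ℚ 1ℚ (E m)) + card (diffG (E m))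
      ≤⟨ +-mono-≤ (+-mono-≤ (+-mono-≤ (card-≤ (sums-in-layer m)) (card-≤ (quotients-in-layer m)))
                                      (card-≤ (shifted-quotients-in-layer m)))
                   (card-≤ (differences-in-layer m)) ⟩
    length (layer (base m) (m + m) m) + length (layer (base m) m m)
      + length (layer (base m) (m + m) (m + m)) + length (layer (m * m) (m + m) m)
      ≡⟨ cong₂ _+_ (cong₂ _+_ (cong₂ _+_ (length-layer (base m) (m + m) m) (length-layer (base m) m m))
                               (length-layer (base m) (m + m) (m + m)))
                   (length-layer (m * m) (m + m) m) ⟩
    (m + m) * m + m * m + (m + m) * (m + m) + (m + m) * m
      ≡⟨ solve (m ∷ []) ⟩
    9 * (m * m) ∎
    where open ≤-Reasoning

  E-length-squared : ∀ m → (m * m) * (m * m) * (m * m) ≡ length (E m) * length (E m)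
  E-length-squared m = begin
    (m * m) * (m * m) * (m * m)      ≡⟨ solve (m ∷ []) ⟩
    m * (m * m) * (m * (m * m))      ≡⟨ cong₂ _*_ (E-length m) (E-length m) ⟨
    length (E m) * length (E m)      ∎
    where open ≡-Reasoning

open import Defs
open import Data.Nat using (ℕ; _≤_)
open import Data.Rational using (ℚ; Positive; 1ℚ; _*_) renaming (_≤_ to _≤ℚ_; _+_ to _+ℚ_)
open import Data.Product using (Σ; _×_; proj₁; proj₂)
open import Data.List using (List; length)
open import Data.List.Relation.Unary.All using (All)
open import Data.List.Relation.Unary.Unique.Propositional using (Unique)
open import Data.List.Membership.Propositional using (_∈_)
open import Data.Nat as ℕ using (suc)
open import Data.Nat.Properties using (≤-trans; ≤-reflexive; n≤1+n; m≤m*n)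
open import Data.Product using (_,_)
open import Data.Rational.Properties using (*-identityˡ)
open import Relation.Binary.PropositionalEquality using (subst; subst₂; sym; trans)
open Fractions using (ℕtoℚ-*; ℕtoℚ-*₃; ℕtoℚ-+₄; ℕtoℚ-mono-≤)
open Construction

theorem9 :
    Σ ℚ λ c₁ → Σ ℚ λ c₂ → Σ ℚ λ c₃ → Σ ℚ λ c₄ →
      Positive c₁ × Positive c₂ × Positive c₃ × Positive c₄ ×
      ((N : ℕ) → Σ ℕ λ n → N ≤ n ×
        Σ (List ℚ) λ A → Σ (List (ℚ × ℚ)) λ E →
          Unique A × All Positive A ×
          Unique E × All (λ e → (proj₁ e ∈ A) × (proj₂ e ∈ A)) E ×
          (c₁ * ℕtoℚ n) ≤ℚ ℕtoℚ (length A) ×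
          ℕtoℚ (length A) ≤ℚ (c₂ * ℕtoℚ n) ×
          ((c₃ * c₃) * (ℕtoℚ n * ℕtoℚ n * ℕtoℚ n))
            ≤ℚ (ℕtoℚ (length E) * ℕtoℚ (length E)) ×
          (ℕtoℚ (card (sumG E)) +ℚ ℕtoℚ (card (quotG E))
            +ℚ ℕtoℚ (card (quotShiftG 1ℚ 1ℚ E)) +ℚ ℕtoℚ (card (diffG E)))
            ≤ℚ (c₄ * ℕtoℚ n))
theorem9 = 1ℚ , ℕtoℚ 2 , 1ℚ , ℕtoℚ 9 , _ , _ , _ , _ , λ N →
  let m = suc N
      n = m ℕ.* m
      |A| = length (A m)
      |E| = length (E m)
      sums = card (sumG (E m))
      quotients = card (quotG (E m))
      shifted = card (quotShiftG 1ℚ 1ℚ (E m))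
      differences = card (diffG (E m))
  in n , ≤-trans (n≤1+n N) (m≤m*n m m) , A m , E m ,
     A-unique m , A-positive N , E-unique m , edges-in-A m ,
     subst (_≤ℚ ℕtoℚ |A|) (sym (*-identityˡ (ℕtoℚ n))) (ℕtoℚ-mono-≤ (A-lower m)) ,
     subst (ℕtoℚ |A| ≤ℚ_) (sym (ℕtoℚ-* 2 n)) (ℕtoℚ-mono-≤ (A-upper m)) ,
     subst₂ _≤ℚ_ (sym (trans (*-identityˡ (ℕtoℚ n * ℕtoℚ n * ℕtoℚ n)) (ℕtoℚ-*₃ n n n)))
                 (sym (ℕtoℚ-* |E| |E|)) (ℕtoℚ-mono-≤ (≤-reflexive (E-length-squared m))) ,
     subst₂ _≤ℚ_ (sym (ℕtoℚ-+₄ sums quotients shifted differences)) (sym (ℕtoℚ-* 9 n)) (ℕtoℚ-mono-≤ (restricted-sets-bound m))
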